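{- Let $G$ be a simple graph of even order $n$ with $m$ edges. If every two distinct non-adjacent vertices $u,v\in V(G)$ satisfy $d(u)+d(v)\ge n$, then $m\ge \frac14 n^2$.
   Context: $d(v)$ denotes the degree of vertex $v$ in $G$. -}

module Defs where

open import Data.Nat using (ℕ; zero; suc; _+_; _*_)
open import Data.Nat.Properties using (_<?_)
open import Data.Bool using (Bool; true; false; T)
open import Data.Fin using (Fin; toℕ)
open import Data.List using (List; length; filter)
open import Data.List using (allFin)
open import Relation.Binary.PropositionalEquality using (_≡_)
open import Relation.Nullary using (¬_)
open import Relation.Nullary.Decidable using (_×-dec_)
open import Data.Product using (_×_)
open import Data.Bool.Properties using (T?)

record SimpleGraph (n : ℕ) : Set where
  field
    adj   : Fin n → Fin n → Bool
    sym   : ∀ u v → adj u v ≡ adj v u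
    irrefl : ∀ v → adj v v ≡ false

open SimpleGraph public

Adj : ∀ {n} → SimpleGraph n → Fin n → Fin n → Set
Adj G u v = T (adj G u v)

degree : ∀ {n} → SimpleGraph n → Fin n → ℕ
degree G v = length (filter (λ u → T? (adj G v u)) (allFin _))

edgeCount : ∀ {n} → SimpleGraph n → ℕ
edgeCount {n} G =
  length (filter (λ p → (toℕ (Data.Product.proj₁ p) <? toℕ (Data.Product.proj₂ p))
                         ×-dec T? (adj G (Data.Product.proj₁ p) (Data.Product.proj₂ p)))
                 (Data.List.cartesianProduct (allFin n) (allFin n)))

-- Let v be a vertex of minimum degree δ.  The δ + 1 vertices of the closed
-- neighbourhood N[v] have degree at least δ, and each of the remaining
-- c = n − δ − 1 vertices is non-adjacent to v, so by the degree condition has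
-- degree at least n − δ = c + 1.  Summing, 2m ≥ (δ + 1)δ + c(c + 1).  Since
-- n = (δ + 1) + c is even, δ ≠ c, and then 2((δ + 1)δ + c(c + 1)) − n² =
-- (δ − c)² − 1 ≥ 0.
module Submission where

open import Defs hiding (sym)
open import Data.Nat using (ℕ; suc; _+_; _*_; _≤_; _<_; _∸_; z≤n)
open import Data.Nat.Properties
open import Data.Nat.Tactic.RingSolver using (solve-∀)
open import Algebra.Properties.CommutativeSemigroup +-commutativeSemigroup
  using (interchange; x∙yz≈y∙xz)
open import Data.Fin using (Fin; toℕ; zero)
open import Data.Fin.Properties using (toℕ-injective) renaming (_≟_ to _≟ᶠ_)
open import Data.Bool using (Bool; true; false; T; _∧_; _∨_; not; if_then_else_)
open import Data.Bool.Properties using (T?; ∨-identityʳ)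
open import Data.List using (List; []; _∷_; length; filter; map; _++_; allFin; cartesianProduct)
open import Data.List.Properties using (length-tabulate)
open import Data.List.Extrema.Nat using (argmin; f[argmin]≤f[xs])
import Data.List.Relation.Unary.All as All
open import Data.List.Relation.Unary.All using (All; []; _∷_)
open import Data.List.Relation.Unary.Any using (here; there)
open import Data.List.Membership.Propositional using (_∈_)
open import Data.List.Membership.Propositional.Properties using (∈-allFin)
open import Data.List.Relation.Unary.Unique.Propositional using (Unique; _∷_)
open import Data.List.Relation.Unary.Unique.Propositional.Properties using (allFin⁺)
open import Data.Product using (_,_; _×_; ∃-syntax)
open import Data.Empty using (⊥-elim)
open import Relation.Binary using (DecidableEquality; tri<; tri≈; tri>)
open import Relation.Binary.PropositionalEquality
open import Relation.Nullary using (¬_; yes; no; does)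
open import Relation.Nullary.Decidable using (dec-true; dec-false)
open import Relation.Unary using (Decidable)
open import Function using (id)

variable
  A B : Set

𝟙 : Bool → ℕ
𝟙 true  = 1
𝟙 false = 0

∑ : List A → (A → ℕ) → ℕ
∑ []       f = 0
∑ (x ∷ xs) f = f x + ∑ xs f

syntax ∑ xs (λ x → e) = ∑[ x ∈ xs ] e

∑-cong : ∀ (xs : List A) {f g : A → ℕ} → (∀ x → f x ≡ g x) → ∑ xs f ≡ ∑ xs g
∑-cong []       f≡g = refl
∑-cong (x ∷ xs) f≡g = cong₂ _+_ (f≡g x) (∑-cong xs f≡g)

∑-mono-≤ : ∀ (xs : List A) {f g : A → ℕ} → (∀ x → f x ≤ g x) → ∑ xs f ≤ ∑ xs g
∑-mono-≤ []       f≤g = z≤n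
∑-mono-≤ (x ∷ xs) f≤g = +-mono-≤ (f≤g x) (∑-mono-≤ xs f≤g)

∑-zero : ∀ (xs : List A) → ∑[ x ∈ xs ] 0 ≡ 0
∑-zero []       = refl
∑-zero (x ∷ xs) = ∑-zero xs

∑-+ : ∀ (xs : List A) (f g : A → ℕ) → ∑[ x ∈ xs ] (f x + g x) ≡ ∑ xs f + ∑ xs g
∑-+ []       f g = refl
∑-+ (x ∷ xs) f g rewrite ∑-+ xs f g = interchange (f x) (g x) (∑ xs f) (∑ xs g)

∑-++ : ∀ (xs ys : List A) (f : A → ℕ) → ∑ (xs ++ ys) f ≡ ∑ xs f + ∑ ys f
∑-++ []       ys f = refl
∑-++ (x ∷ xs) ys f = trans (cong (f x +_) (∑-++ xs ys f)) (sym (+-assoc (f x) _ _))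

∑-map : ∀ (xs : List B) (g : B → A) (f : A → ℕ) → ∑ (map g xs) f ≡ ∑[ x ∈ xs ] f (g x)
∑-map []       g f = refl
∑-map (x ∷ xs) g f = cong (f (g x) +_) (∑-map xs g f)

∑-cartesianProduct : ∀ (xs : List A) (ys : List B) f →
  ∑ (cartesianProduct xs ys) f ≡ ∑[ x ∈ xs ] ∑[ y ∈ ys ] f (x , y)
∑-cartesianProduct []       ys f = refl
∑-cartesianProduct (x ∷ xs) ys f = trans (∑-++ (map (x ,_) ys) _ f)
  (cong₂ _+_ (∑-map ys (x ,_) f) (∑-cartesianProduct xs ys f))

∑-comm : ∀ (xs : List A) (ys : List B) (f : A → B → ℕ) →
  ∑[ x ∈ xs ] ∑[ y ∈ ys ] f x y ≡ ∑[ y ∈ ys ] ∑[ x ∈ xs ] f x y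
∑-comm []       ys f = sym (∑-zero ys)
∑-comm (x ∷ xs) ys f =
  trans (cong (∑ ys (f x) +_) (∑-comm xs ys f)) (sym (∑-+ ys (f x) _))

length-filter≡∑ : ∀ {P : A → Set} (P? : Decidable P) (xs : List A) →
  length (filter P? xs) ≡ ∑[ x ∈ xs ] 𝟙 (does (P? x))
length-filter≡∑ P? []       = refl
length-filter≡∑ P? (x ∷ xs) with does (P? x)
... | true  = cong suc (length-filter≡∑ P? xs)
... | false = length-filter≡∑ P? xs

∑-𝟙+∑-𝟙-not : ∀ (xs : List A) (b : A → Bool) →
  ∑[ x ∈ xs ] 𝟙 (b x) + ∑[ x ∈ xs ] 𝟙 (not (b x)) ≡ length xs
∑-𝟙+∑-𝟙-not []       b = refl
∑-𝟙+∑-𝟙-not (x ∷ xs) b with b x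
... | true  = cong suc (∑-𝟙+∑-𝟙-not xs b)
... | false = trans (+-suc _ _) (cong suc (∑-𝟙+∑-𝟙-not xs b))

∑-if : ∀ (xs : List A) (b : A → Bool) (p q : ℕ) →
  ∑[ x ∈ xs ] (if b x then p else q)
    ≡ ∑[ x ∈ xs ] 𝟙 (b x) * p + ∑[ x ∈ xs ] 𝟙 (not (b x)) * q
∑-if []       b p q = refl
∑-if (x ∷ xs) b p q with b x
... | true  rewrite ∑-if xs b p q = sym (+-assoc p _ _)
... | false rewrite ∑-if xs b p q = x∙yz≈y∙xz q (∑[ x ∈ xs ] 𝟙 (b x) * p) _

module _ (_≟_ : DecidableEquality A) where

  ∑-𝟙-≢ : ∀ v {xs : List A} → All (λ u → ¬ u ≡ v) xs → ∑[ u ∈ xs ] 𝟙 (does (u ≟ v)) ≡ 0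
  ∑-𝟙-≢ v []                   = refl
  ∑-𝟙-≢ v {u ∷ _} (u≢v ∷ xs≢v) with u ≟ v
  ... | yes u≡v = ⊥-elim (u≢v u≡v)
  ... | no  _   = ∑-𝟙-≢ v xs≢v

  ∑-𝟙-≡-unique : ∀ v {xs : List A} → Unique xs → v ∈ xs → ∑[ u ∈ xs ] 𝟙 (does (u ≟ v)) ≡ 1
  ∑-𝟙-≡-unique v {u ∷ _} (u∉xs ∷ _) (here refl) with u ≟ u
  ... | yes _   = cong suc (∑-𝟙-≢ u (All.map (λ u≢w w≡u → u≢w (sym w≡u)) u∉xs))
  ... | no  u≢u = ⊥-elim (u≢u refl)
  ∑-𝟙-≡-unique v {u ∷ _} (u∉xs ∷ xs-unique) (there v∈xs) with u ≟ v
  ... | yes refl = ⊥-elim (All.lookup u∉xs v∈xs refl)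
  ... | no  _    = ∑-𝟙-≡-unique v xs-unique v∈xs

pronic : ℕ → ℕ
pronic a = a * suc a

<⇒square≤2*[pronic+pronic] : ∀ {a c} → a < c →
  (suc a + c) * (suc a + c) ≤ 2 * (pronic a + pronic c)
<⇒square≤2*[pronic+pronic] {a} a<c with j , refl ← m≤n⇒∃[o]m+o≡n a<c =
  subst ((suc a + (suc a + j)) * (suc a + (suc a + j)) ≤_) (sym (excess a j)) (m≤m+n _ _)
  where
  excess : ∀ a j → 2 * (a * suc a + (suc a + j) * suc (suc a + j))
                 ≡ (suc a + (suc a + j)) * (suc a + (suc a + j)) + j * suc (suc j)
  excess = solve-∀

≢⇒square≤2*[pronic+pronic] : ∀ {a c} → ¬ a ≡ c →
  (suc a + c) * (suc a + c) ≤ 2 * (pronic a + pronic c)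
≢⇒square≤2*[pronic+pronic] {a} {c} a≢c with <-cmp a c
... | tri< a<c _ _ = <⇒square≤2*[pronic+pronic] a<c
... | tri≈ _ a≡c _ = ⊥-elim (a≢c a≡c)
... | tri> _ _ c<a = subst₂ (λ s t → s * s ≤ 2 * t)
  (cong suc (+-comm c a)) (+-comm (pronic c) (pronic a)) (<⇒square≤2*[pronic+pronic] c<a)

1+m+n≡2*k⇒m≢n : ∀ {m n} k → suc m + n ≡ 2 * k → ¬ m ≡ n
1+m+n≡2*k⇒m≢n {m} k 1+m+m≡2k refl =
  even≢odd k m (trans (sym 1+m+m≡2k) (cong (λ n → suc (m + n)) (sym (+-identityʳ m))))

module _ {n : ℕ} (G : SimpleGraph n) where

  adj< : Fin n → Fin n → Bool
  adj< u w = does (toℕ u <? toℕ w) ∧ adj G u w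

  degree≡∑ : ∀ u → degree G u ≡ ∑[ w ∈ allFin n ] 𝟙 (adj G u w)
  degree≡∑ u = length-filter≡∑ (λ w → T? (adj G u w)) (allFin n)

  edgeCount≡∑ : edgeCount G ≡ ∑[ u ∈ allFin n ] ∑[ w ∈ allFin n ] 𝟙 (adj< u w)
  edgeCount≡∑ = trans (length-filter≡∑ _ (cartesianProduct (allFin n) (allFin n)))
                      (∑-cartesianProduct (allFin n) (allFin n) _)

  𝟙-adj≡𝟙-adj<+𝟙-adj> : ∀ u w → 𝟙 (adj G u w) ≡ 𝟙 (adj< u w) + 𝟙 (adj< w u)
  𝟙-adj≡𝟙-adj<+𝟙-adj> u w with <-cmp (toℕ u) (toℕ w)
  ... | tri< u<w _ w≮u
    rewrite dec-true (toℕ u <? toℕ w) u<w | dec-false (toℕ w <? toℕ u) w≮u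
    = sym (+-identityʳ _)
  ... | tri> u≮w _ w<u
    rewrite dec-false (toℕ u <? toℕ w) u≮w | dec-true (toℕ w <? toℕ u) w<u | SimpleGraph.sym G w u
    = refl
  ... | tri≈ u≮u u≡w _ with refl ← toℕ-injective u≡w
    rewrite dec-false (toℕ u <? toℕ u) u≮u | irrefl G u
    = refl

  handshake : ∑[ u ∈ allFin n ] degree G u ≡ 2 * edgeCount G
  handshake = begin
    ∑[ u ∈ V ] degree G u                                       ≡⟨ ∑-cong V degree≡∑ ⟩
    ∑[ u ∈ V ] ∑[ w ∈ V ] 𝟙 (adj G u w)                         ≡⟨ ∑-cong V (λ u → ∑-cong V (𝟙-adj≡𝟙-adj<+𝟙-adj> u)) ⟩
    ∑[ u ∈ V ] ∑[ w ∈ V ] (𝟙 (adj< u w) + 𝟙 (adj< w u))         ≡⟨ ∑-cong V (λ u → ∑-+ V _ _) ⟩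
    ∑[ u ∈ V ] (∑[ w ∈ V ] 𝟙 (adj< u w) + ∑[ w ∈ V ] 𝟙 (adj< w u)) ≡⟨ ∑-+ V _ _ ⟩
    m + ∑[ u ∈ V ] ∑[ w ∈ V ] 𝟙 (adj< w u)                       ≡⟨ cong (m +_) (∑-comm V V (λ u w → 𝟙 (adj< w u))) ⟩
    m + m                                                        ≡⟨ cong (m +_) (sym (+-identityʳ m)) ⟩
    2 * m                                                        ≡⟨ cong (2 *_) (sym edgeCount≡∑) ⟩
    2 * edgeCount G                                              ∎
    where
    open ≡-Reasoning
    V : List (Fin n)
    V = allFin n
    m : ℕ
    m = ∑[ u ∈ V ] ∑[ w ∈ V ] 𝟙 (adj< u w)

  closedNbr : Fin n → Fin n → Bool
  closedNbr v u = adj G v u ∨ does (u ≟ᶠ v)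

  ∑-𝟙-closedNbr : ∀ v → ∑[ u ∈ allFin n ] 𝟙 (closedNbr v u) ≡ suc (degree G v)
  ∑-𝟙-closedNbr v = begin
    ∑[ u ∈ V ] 𝟙 (closedNbr v u)                                  ≡⟨ ∑-cong V 𝟙-closedNbr ⟩
    ∑[ u ∈ V ] (𝟙 (adj G v u) + 𝟙 (does (u ≟ᶠ v)))                ≡⟨ ∑-+ V _ _ ⟩
    ∑[ u ∈ V ] 𝟙 (adj G v u) + ∑[ u ∈ V ] 𝟙 (does (u ≟ᶠ v))      ≡⟨ cong₂ _+_ (sym (degree≡∑ v)) (∑-𝟙-≡-unique _≟ᶠ_ v (allFin⁺ n) (∈-allFin v)) ⟩
    degree G v + 1                                                ≡⟨ +-comm (degree G v) 1 ⟩
    suc (degree G v)                                              ∎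
    where
    open ≡-Reasoning
    V : List (Fin n)
    V = allFin n
    𝟙-closedNbr : ∀ u → 𝟙 (adj G v u ∨ does (u ≟ᶠ v)) ≡ 𝟙 (adj G v u) + 𝟙 (does (u ≟ᶠ v))
    𝟙-closedNbr u with u ≟ᶠ v
    ... | yes refl rewrite irrefl G v = refl
    ... | no  _    rewrite ∨-identityʳ (adj G v u) = sym (+-identityʳ _)

  module _ (ore : ∀ u v → ¬ u ≡ v → ¬ Adj G u v → n ≤ degree G u + degree G v)
           {v : Fin n} (v-minimal : ∀ u → degree G v ≤ degree G u) where

    degree-lower-bound : ∀ u →
      (if closedNbr v u then degree G v else n ∸ degree G v) ≤ degree G u
    degree-lower-bound u with adj G v u in v~u | u ≟ᶠ v
    ... | true  | _        = v-minimal u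
    ... | false | yes refl = ≤-refl
    ... | false | no  u≢v  = m≤n+o⇒m∸n≤o n (degree G v)
      (ore v u (λ v≡u → u≢v (sym v≡u)) (subst T v~u))

    degree-sum-lower-bound :
      ∃[ c ] (suc (degree G v) + c ≡ n × pronic (degree G v) + pronic c ≤ 2 * edgeCount G)
    degree-sum-lower-bound = c , size , bound
      where
      V : List (Fin n)
      V = allFin n
      δ : ℕ
      δ = degree G v
      c : ℕ
      c = ∑[ u ∈ V ] 𝟙 (not (closedNbr v u))

      size : suc δ + c ≡ n
      size = trans (cong (_+ c) (sym (∑-𝟙-closedNbr v)))
                   (trans (∑-𝟙+∑-𝟙-not V (closedNbr v)) (length-tabulate id))

      n∸δ≡1+c : n ∸ δ ≡ suc c
      n∸δ≡1+c = trans (cong (_∸ δ) (trans (sym size) (sym (+-suc δ c)))) (m+n∸m≡n δ (suc c))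

      bound : pronic δ + pronic c ≤ 2 * edgeCount G
      bound = begin
        pronic δ + pronic c                                       ≡⟨ cong₂ (λ x y → x + c * y) (*-comm δ (suc δ)) (sym n∸δ≡1+c) ⟩
        suc δ * δ + c * (n ∸ δ)                                   ≡⟨ cong (λ x → x * δ + c * (n ∸ δ)) (sym (∑-𝟙-closedNbr v)) ⟩
        ∑[ u ∈ V ] 𝟙 (closedNbr v u) * δ + c * (n ∸ δ)            ≡⟨ sym (∑-if V (closedNbr v) δ (n ∸ δ)) ⟩
        ∑[ u ∈ V ] (if closedNbr v u then δ else n ∸ δ)           ≤⟨ ∑-mono-≤ V degree-lower-bound ⟩
        ∑[ u ∈ V ] degree G u                                     ≡⟨ handshake ⟩
        2 * edgeCount G                                           ∎
        where open ≤-Reasoning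

∃-minimiser : ∀ {n} (f : Fin n → ℕ) → Fin n → ∃[ v ] (∀ u → f v ≤ f u)
∃-minimiser {n} f v₀ = argmin f v₀ (allFin n) , λ u →
  All.lookup (f[argmin]≤f[xs] {f = f} v₀ (allFin n)) (∈-allFin u)

lemma1 : (k : ℕ) → (G : SimpleGraph (2 * k))
    → (∀ (u v : Fin (2 * k)) → ¬ (u ≡ v) → ¬ Adj G u v → 2 * k ≤ degree G u + degree G v)
    → (2 * k) * (2 * k) ≤ 4 * edgeCount G
lemma1 0       G ore = z≤n
lemma1 (suc k) G ore =
  let v , v-minimal  = ∃-minimiser (degree G) zero
      δ              = degree G v
      c , size , bound = degree-sum-lower-bound G ore v-minimal
  in begin
  (2 * suc k) * (2 * suc k)     ≡⟨ cong (λ x → x * x) size ⟨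
  (suc δ + c) * (suc δ + c)     ≤⟨ ≢⇒square≤2*[pronic+pronic] {δ} {c} (1+m+n≡2*k⇒m≢n (suc k) size) ⟩
  2 * (pronic δ + pronic c)     ≤⟨ *-monoʳ-≤ 2 bound ⟩
  2 * (2 * edgeCount G)         ≡⟨ *-assoc 2 2 (edgeCount G) ⟨
  4 * edgeCount G               ∎
  where open ≤-Reasoning
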